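{- Let $\mathcal V$ be a unital commutative quantale, $F\colon\mathsf{Set}\to\mathsf{Set}$ a functor and $\hat F$ a lifting of $F$ to $\mathcal V\text{ - }\mathsf{Pred}$. Define $\bar F$ on objects of $\mathcal V\text{ - }\mathsf{Rel}$ by $\bar F(r)(t_1,t_2)=\bigvee\{\hat F(r)(t)\mid t\in F(X\times X),\ F\pi_1(t)=t_1,\ F\pi_2(t)=t_2\}$ for $r\colon X\times X\to\mathcal V$ (regarded as a predicate on $X\times X$, so that $\hat F(r)$ is a predicate on $F(X\times X)$) and $t_1,t_2\in FX$, and on morphisms by $\bar F(f)=Ff$. Then $\bar F$ is a well-defined lifting of $F$ to $\mathcal V\text{ - }\mathsf{Rel}$ (i.e. whenever $f\colon X\to Y$ satisfies $r\le q\circ(f\times f)$, then $\bar F(r)\le \bar F(q)\circ(Ff\times Ff)$). Furthermore, if $F$ preserves weak pullbacks and $\hat F$ is a fibred lifting, then $\bar F$ is a fibred lifting of $F$ to $\mathcal V\text{ - }\mathsf{Rel}$.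
   Context: A unital commutative quantale $\mathcal V$ is a complete lattice $(\mathcal V,\le)$ with an associative, commutative operation $\otimes$ distributing over arbitrary joins $\bigvee$, with unit $1$. $\mathcal V\text{ - }\mathsf{Pred}$: objects are maps $p\colon X\to\mathcal V$; morphisms $p\to q$ (with $q\colon Y\to\mathcal V$) are functions $f\colon X\to Y$ with $p\le q\circ f$ pointwise. $\mathcal V\text{ - }\mathsf{Rel}$: objects are maps $r\colon X\times X\to\mathcal V$; morphisms $r\to q$ (with $q\colon Y\times Y\to\mathcal V$) are functions $f\colon X\to Y$ with $r\le q\circ(f\times f)$. A lifting of $F$ to $\mathcal V\text{ - }\mathsf{Pred}$ (resp. $\mathcal V\text{ - }\mathsf{Rel}$) is a functor sending each predicate (resp. relation) on $X$ to one on $FX$ and each morphism $f$ to $Ff$. A lifting $\hat F$ to $\mathcal V\text{ - }\mathsf{Pred}$ is fibred if $\hat F(q\circ f)=\hat F(q)\circ Ff$ for all $f\colon X\to Y$, $q\colon Y\to \mathcal V$; a lifting $\bar F$ to $\mathcal V\text{ - }\mathsf{Rel}$ is fibred if $\bar F(q\circ(f\times f))=\bar F(q)\circ(Ff\times Ff)$ for all $f\colon X\to Y$, $q\colon Y\times Y\to\mathcal V$. Here $\pi_1,\pi_2\colon X\times X\to X$ are the projections. -}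

module Defs where

open import Data.Product using (Σ; _×_; _,_; proj₁; proj₂; Σ-syntax)
open import Function using (_∘_; id)
open import Relation.Binary.PropositionalEquality using (_≡_)

record Quantale : Set₁ where
  infix  4 _≤_
  infixl 7 _⊗_
  field
    Carrier   : Set
    _≤_       : Carrier → Carrier → Set
    ≤-refl    : ∀ {a} → a ≤ a
    ≤-trans   : ∀ {a b c} → a ≤ b → b ≤ c → a ≤ c
    ≤-antisym : ∀ {a b} → a ≤ b → b ≤ a → a ≡ b
    ⋁         : {I : Set} → (I → Carrier) → Carrier
    ⋁-ub      : ∀ {I : Set} (f : I → Carrier) (i : I) → f i ≤ ⋁ f
    ⋁-least   : ∀ {I : Set} (f : I → Carrier) (a : Carrier) →
                (∀ i → f i ≤ a) → ⋁ f ≤ a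
    _⊗_       : Carrier → Carrier → Carrier
    unit      : Carrier
    ⊗-assoc   : ∀ a b c → (a ⊗ b) ⊗ c ≡ a ⊗ (b ⊗ c)
    ⊗-comm    : ∀ a b → a ⊗ b ≡ b ⊗ a
    ⊗-unitˡ   : ∀ a → unit ⊗ a ≡ a
    ⊗-distrib-⋁ : ∀ {I : Set} (a : Carrier) (f : I → Carrier) →
                  a ⊗ ⋁ f ≡ ⋁ (λ i → a ⊗ f i)

-- Endofunctors on Set (laws stated pointwise, since there is no funext)

record Functor : Set₁ where
  field
    F₀      : Set → Set
    fmap    : ∀ {X Y : Set} → (X → Y) → F₀ X → F₀ Y
    fmap-id : ∀ {X : Set} (t : F₀ X) → fmap (id {A = X}) t ≡ t
    fmap-∘  : ∀ {X Y Z : Set} (g : Y → Z) (f : X → Y) (t : F₀ X) →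
              fmap (g ∘ f) t ≡ fmap g (fmap f t)
    fmap-cong : ∀ {X Y : Set} {f g : X → Y} → (∀ x → f x ≡ g x) →
                ∀ t → fmap f t ≡ fmap g t

IsWeakPullback : {P A B C : Set} → (P → A) → (P → B) → (A → C) → (B → C) → Set
IsWeakPullback {P} {A} {B} p₁ p₂ f g =
  (∀ x → f (p₁ x) ≡ g (p₂ x)) ×
  (∀ (a : A) (b : B) → f a ≡ g b → Σ[ x ∈ P ] (p₁ x ≡ a × p₂ x ≡ b))

PreservesWeakPullbacks : Functor → Set₁
PreservesWeakPullbacks F =
  ∀ {P A B C : Set} (p₁ : P → A) (p₂ : P → B) (f : A → C) (g : B → C) →
  IsWeakPullback p₁ p₂ f g →
  IsWeakPullback (fmap p₁) (fmap p₂) (fmap f) (fmap g)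
  where open Functor F

module _ (V : Quantale) where
  open Quantale V

  _≤̇_ : {X : Set} → (X → Carrier) → (X → Carrier) → Set
  p ≤̇ q = ∀ x → p x ≤ q x

  Pred : Set → Set
  Pred X = X → Carrier

  Rel : Set → Set
  Rel X = X × X → Carrier

  _⊗₂_ : {X Y : Set} → (X → Y) → X × X → Y × Y
  (f ⊗₂ (x , y)) = f x , f y
  infix 9 _⊗₂_

  module _ (F : Functor) where
    open Functor F

    -- A lifting of F to V-Pred: object map + functoriality condition
    -- (morphisms are sent to F f).
    record PredLifting : Set₁ where
      field
        lift  : {X : Set} → Pred X → Pred (F₀ X)
        lift-mor : ∀ {X Y : Set} (p : Pred X) (q : Pred Y) (f : X → Y) →
                   p ≤̇ (q ∘ f) → lift p ≤̇ (lift q ∘ fmap f)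

    IsFibredPred : PredLifting → Set₁
    IsFibredPred L = ∀ {X Y : Set} (f : X → Y) (q : Pred Y) (t : F₀ X) →
                     lift (q ∘ f) t ≡ lift q (fmap f t)
      where open PredLifting L

    RelObjMap : Set₁
    RelObjMap = {X : Set} → Rel X → Rel (F₀ X)

    IsRelLifting : RelObjMap → Set₁
    IsRelLifting R = ∀ {X Y : Set} (r : Rel X) (q : Rel Y) (f : X → Y) →
                     r ≤̇ (q ∘ (f ⊗₂_)) → R r ≤̇ (R q ∘ (fmap f ⊗₂_))

    IsFibredRel : RelObjMap → Set₁
    IsFibredRel R = ∀ {X Y : Set} (f : X → Y) (q : Rel Y) (s : F₀ X × F₀ X) →
                    R (q ∘ (f ⊗₂_)) s ≡ R q (fmap f ⊗₂ s)

    barF : PredLifting → RelObjMap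
    barF L {X} r (t₁ , t₂) =
      ⋁ {I = Σ[ t ∈ F₀ (X × X) ] (fmap proj₁ t ≡ t₁ × fmap proj₂ t ≡ t₂)}
        (λ i → lift r (proj₁ i))
      where open PredLifting L

-- A coupling of t₁ and t₂ pushed forward along F f is a coupling of F f t₁ and F f t₂,
-- so F̄ inherits the lifting property from F̂. For fibredness, F̄(q ∘ (f × f)) ≤ F̄(q) ∘ (Ff × Ff)
-- is this lifting property again. Conversely, a coupling t of F f s₁ and F f s₂ is, because F
-- preserves the weak pullbacks X × Y ⇉ Y × Y and X × X ⇉ X × Y of f × id and id × f, the image
-- under F(f × f) of a coupling t' of s₁ and s₂; fibredness of F̂ gives F̂(q)(t) = F̂(q ∘ (f × f))(t').
module Submission where

open import Defs
open import Data.Product using (_×_; _,_; proj₁; proj₂; Σ-syntax; map; map₁; map₂′)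
open import Function using (_∘_)
open import Relation.Binary.PropositionalEquality using (_≡_; refl; sym; trans; cong; subst)

map₁-isWeakPullback : {A B C : Set} (f : A → C) →
                      IsWeakPullback (map₁ {C = B} f) proj₁ proj₁ f
map₁-isWeakPullback f =
  (λ _ → refl) , λ { (c , b) a fa≡c → (a , b) , cong (_, b) (sym fa≡c) , refl }

map₂-isWeakPullback : {A B C : Set} (f : A → C) →
                      IsWeakPullback (map₂′ {A = B} f) proj₂ proj₂ f
map₂-isWeakPullback f =
  (λ _ → refl) , λ { (b , c) a fa≡c → (b , a) , cong (b ,_) (sym fa≡c) , refl }

module _ (F : Functor) where
  open Functor F

  fmap-∘-≗ : {X Y Z : Set} {g : Y → Z} {f : X → Y} {h : X → Z} →
             (∀ x → g (f x) ≡ h x) → ∀ t → fmap g (fmap f t) ≡ fmap h t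
  fmap-∘-≗ g∘f≗h t = trans (sym (fmap-∘ _ _ t)) (fmap-cong g∘f≗h t)

  Coupling : {X : Set} → F₀ X → F₀ X → Set
  Coupling {X} t₁ t₂ = Σ[ t ∈ F₀ (X × X) ] (fmap proj₁ t ≡ t₁ × fmap proj₂ t ≡ t₂)

  coupling-map : {X Y : Set} (f : X → Y) {t₁ t₂ : F₀ X} →
                 Coupling t₁ t₂ → Coupling (fmap f t₁) (fmap f t₂)
  coupling-map f (t , π₁t≡t₁ , π₂t≡t₂) =
    fmap (map f f) t ,
    trans (fmap-∘-≗ (λ _ → refl) t) (trans (fmap-∘ f proj₁ t) (cong (fmap f) π₁t≡t₁)) ,
    trans (fmap-∘-≗ (λ _ → refl) t) (trans (fmap-∘ f proj₂ t) (cong (fmap f) π₂t≡t₂))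

  coupling-pullback : PreservesWeakPullbacks F → {X Y : Set} (f : X → Y) {s₁ s₂ : F₀ X}
                      (c : Coupling (fmap f s₁) (fmap f s₂)) →
                      Σ[ c′ ∈ Coupling s₁ s₂ ] fmap (map f f) (proj₁ c′) ≡ proj₁ c
  coupling-pullback preserves {X} {Y} f {s₁} {s₂} (t , π₁t≡fs₁ , π₂t≡fs₂)
    with proj₂ (preserves _ _ _ _ (map₁-isWeakPullback {B = Y} f)) t s₁ π₁t≡fs₁
  ... | u , fu≡t , π₁u≡s₁
    with proj₂ (preserves _ _ _ _ (map₂-isWeakPullback {B = X} f)) u s₂ π₂u≡fs₂
    where
    π₂u≡fs₂ : fmap proj₂ u ≡ fmap f s₂
    π₂u≡fs₂ = trans (sym (fmap-∘-≗ (λ _ → refl) u)) (trans (cong (fmap proj₂) fu≡t) π₂t≡fs₂)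
  ... | t′ , ft′≡u , π₂t′≡s₂ = (t′ , π₁t′≡s₁ , π₂t′≡s₂) , ff-t′≡t
    where
    π₁t′≡s₁ : fmap proj₁ t′ ≡ s₁
    π₁t′≡s₁ = trans (sym (fmap-∘-≗ (λ _ → refl) t′)) (trans (cong (fmap proj₁) ft′≡u) π₁u≡s₁)
    ff-t′≡t : fmap (map f f) t′ ≡ t
    ff-t′≡t = trans (sym (fmap-∘-≗ (λ _ → refl) t′)) (trans (cong (fmap (map₁ f)) ft′≡u) fu≡t)

module _ (V : Quantale) (F : Functor) (L : PredLifting V F) where
  open Quantale V
  open Functor F
  open PredLifting L

  barF-isRelLifting : IsRelLifting V F (barF V F L)
  barF-isRelLifting r q f r≤q∘ff _ = ⋁-least _ _ λ c →
    ≤-trans (lift-mor r q (map f f) r≤q∘ff (proj₁ c)) (⋁-ub _ (coupling-map F f c))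

  barF-isFibredRel : PreservesWeakPullbacks F → IsFibredPred V F L →
                     IsFibredRel V F (barF V F L)
  barF-isFibredRel preserves fibred f q s = ≤-antisym
    (barF-isRelLifting (q ∘ map f f) q f (λ _ → ≤-refl) s)
    (⋁-least _ _ λ c →
      let (c′ , ff-c′≡c) = coupling-pullback F preserves f c
      in subst (_≤ barF V F L (q ∘ map f f) s)
               (trans (fibred (map f f) q (proj₁ c′)) (cong (lift q) ff-c′≡c))
               (⋁-ub _ c′))

proposition17 : (V : Quantale) (F : Functor) (L : PredLifting V F) →
    IsRelLifting V F (barF V F L) ×
    (PreservesWeakPullbacks F → IsFibredPred V F L → IsFibredRel V F (barF V F L))
proposition17 V F L = barF-isRelLifting V F L , barF-isFibredRel V F L
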